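{- Let $R,S$ be finite undirected graphs and $\mathfrak{U}'\subseteq\mathfrak{U}$. Assume that either $\mathfrak{U}'=\mathfrak{U}$ (with $R\in\mathfrak{U}$), or $R\in\mathfrak{C}_o\subseteq\mathfrak{U}'\subseteq\mathfrak{U}$. Let $\mathcal{E}(R),\mathcal{E}(S)$ be the EV-systems of $R$ and $S$ with respect to $\mathfrak{U}'$. Let $\rho$ be a strong S-scheme from $R$ to $S$ with respect to $\mathfrak{U}'$ such that, for all $G,H\in\mathfrak{U}'$, $\xi\in\mathcal{S}_u(G,R)$, $\zeta\in\mathcal{S}_u(H,R)$, $v\in V(G)$, $w\in V(H)$, $$\alpha^R_{G,\xi}(v)=\alpha^R_{H,\zeta}(w)\ \Longrightarrow\ \alpha^S_{G,\rho_G(\xi)}(v)=\alpha^S_{H,\rho_H(\zeta)}(w).$$ Put $\epsilon:=\alpha^S_{\mathcal{E}(R),\,\rho_{\mathcal{E}(R)}(\phi_R)}$. Then: - $\epsilon$ is one-to-one; - $\epsilon$ induces $\rho$, i.e. $\rho_G(\xi)=\phi_S\circ\epsilon\circ\alpha^R_{G,\xi}$ for all $G\in\mathfrak{U}'$ and $\xi\in\mathcal{S}_u(G,R)$; - $\epsilon$ fulfills Condition 1, i.e. $\alpha^S_{G,\rho_G(\xi)}=\epsilon\circ\alpha^R_{G,\xi}$ for all $G\in\mathfrak{U}'$ and $\xi\in\mathcal{S}_u(G,R)$.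
   Context: An undirected graph $G$ has a finite nonempty vertex set $V(G)$ and an edge set $A(G)$ consisting of subsets of $V(G)$ of size 1 (loops) or 2 (proper edges). $G^*$ is $G$ with loops removed. $N_G(v)$ is the set of $w\neq v$ with $\{v,w\}\in A(G)$. A homomorphism $\xi:G\to H$ is a map $V(G)\to V(H)$ sending every edge $\{v,w\}$ to an edge $\{\xi(v),\xi(w)\}$. It is strict if, in addition, it sends proper edges to proper edges. $\mathcal{S}_u(G,H)$ is the set of strict homomorphisms. Classes of graphs: - $\mathfrak{U}$ is a representative system of the isomorphism classes of finite undirected graphs; constructed graphs are identified with their representatives. - $\mathfrak{C}_o=\{G\in\mathfrak{U}: G^*\text{ contains no cycle of odd length}\}$. An S-scheme from $R$ to $S$ with respect to $\mathfrak{U}'$ is a family of maps $\rho_G:\mathcal{S}_u(G,R)\to\mathcal{S}_u(G,S)$, $G\in\mathfrak{U}'$. It is strong if each $\rho_G$ is injective. EV-system of an undirected graph $T$ with respect to $\mathfrak{U}'$: - Vertex set $\mathcal{E}_o(T)=\{(v,D):v\in V(T),\ D\subseteq N_T(v)\}$, with components $\mathfrak{a}_1,\mathfrak{a}_2$. - $\phi_T(\mathfrak{a})=\mathfrak{a}_1$. - For $G\in\mathfrak{U}'$ and $\xi\in\mathcal{S}_u(G,T)$, $\alpha^T_{G,\xi}(v)=(\xi(v),\xi[N_G(v)])$. - $\{\mathfrak{a},\mathfrak{b}\}$ (where $\mathfrak{a}=\mathfrak{b}$ is allowed) is an edge of $\mathcal{E}(T)$ iff there exist $G\in\mathfrak{U}'$,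 $\xi\in\mathcal{S}_u(G,T)$ and $\{v,w\}\in A(G)$ (where $v=w$ is allowed) with $\mathfrak{a}=\alpha^T_{G,\xi}(v)$ and $\mathfrak{b}=\alpha^T_{G,\xi}(w)$. In both settings $\mathcal{E}(R)\in\mathfrak{U}'$ and $\phi_R\in\mathcal{S}_u(\mathcal{E}(R),R)$, so $\epsilon$ is defined. -}

module Defs where

open import Data.Nat using (ℕ; zero; suc; _+_; _*_)
open import Data.Bool using (Bool; true; false; T)
import Data.Bool.Properties as BoolP
open import Data.Fin using (Fin; zero; suc; inject₁; fromℕ; _≟_)
open import Data.Fin.Properties using (any?)
open import Data.Fin.Subset using (Subset; _∈_; _⊆_; inside)
open import Data.Fin.Subset.Properties using (_∈?_)
open import Data.Vec using (tabulate; lookup)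
open import Data.Vec.Properties using (lookup∘tabulate; []=⇒lookup; lookup⇒[]=)
open import Data.Product using (Σ; Σ-syntax; ∃; ∃-syntax; _×_; _,_; proj₁; proj₂)
open import Data.Sum using (_⊎_)
open import Data.Empty using (⊥)
open import Relation.Nullary using (¬_; Dec; yes; no; does)
open import Relation.Nullary.Decidable using (_×-dec_; ¬?; toWitness; fromWitness)
open import Relation.Binary.PropositionalEquality using (_≡_; _≢_; refl; sym; trans; cong; subst; subst₂)
open import Function.Bundles using (_↔_; _⇔_; Inverse; Equivalence)
open import Function.Definitions using (Injective)
-- Finite undirected graphs (loops allowed): vertex set Fin n,
-- a symmetric Bool-valued adjacency; {v,w} ∈ A(G) iff adj v w ≡ true
-- ({v} is a loop iff adj v v ≡ true).

record Graph : Set where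
  field
    n       : ℕ
    adj     : Fin n → Fin n → Bool
    adj-sym : ∀ v w → adj v w ≡ adj w v
open Graph public

V : Graph → Set
V G = Fin (n G)

Adj : (G : Graph) → V G → V G → Set
Adj G v w = adj G v w ≡ true

Adj? : (G : Graph) → ∀ v w → Dec (Adj G v w)
Adj? G v w = adj G v w BoolP.≟ true

AdjStar : (G : Graph) → V G → V G → Set
AdjStar G v w = Adj G v w × v ≢ w

nbhd : (G : Graph) → V G → Subset (n G)
nbhd G v = tabulate λ w → does (Adj? G v w ×-dec ¬? (v ≟ w))

image : ∀ {k m} → (Fin k → Fin m) → Subset k → Subset m
image ξ D = tabulate λ u → does (any? λ w → (w ∈? D) ×-dec (ξ w ≟ u))

IsStrict : (G H : Graph) → (V G → V H) → Set
IsStrict G H f = ∀ v w → Adj G v w → Adj H (f v) (f w) × (v ≢ w → f v ≢ f w)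

record SHom (G H : Graph) : Set where
  constructor shom
  field
    map     : V G → V H
    strict  : IsStrict G H map
open SHom public

record Eo (T : Graph) : Set where
  constructor ⟨_,_,_⟩
  field
    vtx  : V T
    set  : Subset (n T)
    .sub : set ⊆ nbhd T vtx
open Eo public

φ : (T : Graph) → Eo T → V T
φ T = vtx

private
  dec-true : ∀ {A : Set} (d : Dec A) → A → does d ≡ true
  dec-true (yes _) _ = refl
  dec-true (no ¬a) a with ¬a a
  ... | ()

  dec-wit : ∀ {A : Set} (d : Dec A) → does d ≡ true → A
  dec-wit (yes a) _ = a
  dec-wit (no _) ()

  lookup-true : ∀ {k} (D : Subset k) i → lookup D i ≡ true → i ∈ D
  lookup-true D i eq = lookup⇒[]= i D eq

  image-sub : (G T : Graph) (f : V G → V T) (s : IsStrict G T f) (v : V G) →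
              image f (nbhd G v) ⊆ nbhd T (f v)
  image-sub G T f s v {u} u∈ = lookup⇒[]= u (nbhd T (f v)) goal
    where
    l1 : does (any? λ w → (w ∈? nbhd G v) ×-dec (f w ≟ u)) ≡ true
    l1 = trans (sym (lookup∘tabulate _ u)) ([]=⇒lookup u∈)
    wit : ∃ λ w → (w ∈ nbhd G v) × (f w ≡ u)
    wit = dec-wit (any? (λ w → (w ∈? nbhd G v) ×-dec (f w ≟ u))) l1
    w = proj₁ wit
    l2 : does (Adj? G v w ×-dec ¬? (v ≟ w)) ≡ true
    l2 = trans (sym (lookup∘tabulate _ w)) ([]=⇒lookup (proj₁ (proj₂ wit)))
    aw : Adj G v w × v ≢ w
    aw = dec-wit (Adj? G v w ×-dec ¬? (v ≟ w)) l2
    goal : lookup (nbhd T (f v)) u ≡ true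
    goal = subst (λ z → lookup (nbhd T (f v)) z ≡ true) (proj₂ (proj₂ wit)) h
      where
      h : lookup (nbhd T (f v)) (f w) ≡ true
      h = trans (lookup∘tabulate _ (f w))
                (dec-true (Adj? T (f v) (f w) ×-dec ¬? (f v ≟ f w))
                              (proj₁ (s v w (proj₁ aw)) , proj₂ (s v w (proj₁ aw)) (proj₂ aw)))

α : (T G : Graph) → SHom G T → V G → Eo T
α T G (shom f s) v = ⟨ f v , image f (nbhd G v) , image-sub G T f s v ⟩

EVEdge : (U' : Graph → Set) (T : Graph) → Eo T → Eo T → Set
EVEdge U' T 𝔞 𝔟 =
  Σ[ G ∈ Graph ] U' G × Σ[ ξ ∈ SHom G T ] Σ[ v ∈ V G ] Σ[ w ∈ V G ]
    (Adj G v w × α T G ξ v ≡ 𝔞 × α T G ξ w ≡ 𝔟)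

-- A concrete graph realising the EV-system E(T): a graph together with
-- a bijection of its vertex set onto E_o(T) under which its edges are
-- exactly the edges of E(T).
record EVSystem (U' : Graph → Set) (T : Graph) : Set where
  field
    graph : Graph
    enum  : V graph ↔ Eo T
    edges : ∀ x y → Adj graph x y ⇔ EVEdge U' T (Inverse.to enum x) (Inverse.to enum y)
open EVSystem public

φE : ∀ {U' T} (E : EVSystem U' T) → V (graph E) → V T
φE {T = T} E x = φ T (Inverse.to (enum E) x)

φE-strict : ∀ {U' T} (E : EVSystem U' T) → IsStrict (graph E) T (φE E)
φE-strict {U'} {T} E x y axy = helper (Equivalence.to (edges E x y) axy)
  where
  to = Inverse.to (enum E)
  to-inj : ∀ {x y} → to x ≡ to y → x ≡ y
  to-inj {x} {y} eq = trans (sym (Inverse.inverseʳ (enum E) refl))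
                    (trans (cong (Inverse.from (enum E)) eq) (Inverse.inverseʳ (enum E) refl))
  helper : EVEdge U' T (to x) (to y) →
           Adj T (φE E x) (φE E y) × (x ≢ y → φE E x ≢ φE E y)
  helper (G , _ , shom f s , v , w , avw , ex , ey) =
    subst₂ (Adj T) (cong vtx ex) (cong vtx ey) (proj₁ (s v w avw)) , prop
    where
    prop : x ≢ y → φE E x ≢ φE E y
    prop x≢y e with v ≟ w
    ... | yes refl = x≢y (to-inj (trans (sym ex) ey))
    ... | no v≢w = proj₂ (s v w avw) v≢w (trans (cong vtx ex) (trans e (sym (cong vtx ey))))

φE-hom : ∀ {U' T} (E : EVSystem U' T) → SHom (graph E) T
φE-hom E = shom (φE E) (φE-strict E)

-- 𝔠_o : G* contains no cycle of odd length.
-- An odd cycle of length 2m+3 in G*: an injective sequence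
-- c₀,…,c_{2m+2} of vertices with consecutive ones (cyclically) adjacent in G*.

OddCycle : (G : Graph) → ℕ → Set
OddCycle G m =
  Σ[ c ∈ (Fin (suc (2 + 2 * m)) → V G) ]
    Injective _≡_ _≡_ c
    × (∀ (i : Fin (2 + 2 * m)) → AdjStar G (c (inject₁ i)) (c (suc i)))
    × AdjStar G (c (fromℕ (2 + 2 * m))) (c zero)

Co : Graph → Set
Co G = ¬ (∃ λ m → OddCycle G m)

SScheme : (U' : Graph → Set) (R S : Graph) → Set
SScheme U' R S = (G : Graph) → .(U' G) → SHom G R → SHom G S

Strong : ∀ {U' R S} → SScheme U' R S → Set
Strong {U'} {R} ρ = (G : Graph) .(p : U' G) (ξ ζ : SHom G R) →
  (∀ v → map (ρ G p ξ) v ≡ map (ρ G p ζ) v) → ∀ v → map ξ v ≡ map ζ v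

Compatible : ∀ {U' R S} → SScheme U' R S → Set
Compatible {U'} {R} {S} ρ =
  (G H : Graph) .(p : U' G) .(q : U' H) (ξ : SHom G R) (ζ : SHom H R)
  (v : V G) (w : V H) →
  α R G ξ v ≡ α R H ζ w → α S G (ρ G p ξ) v ≡ α S H (ρ H q ζ) w

-- ε := α^S_{E(R), ρ_{E(R)}(φ_R)}, viewed as a map E_o(R) → E_o(S)
-- via the identification V(E(R)) = E_o(R).
ε : ∀ {U' R S} (ρ : SScheme U' R S) (E : EVSystem U' R) .(p : U' (graph E)) →
    Eo R → Eo S
ε {U'} {R} {S} ρ E p 𝔞 =
  α S (graph E) (ρ (graph E) p (φE-hom E)) (Inverse.from (enum E) 𝔞)

-- Everything is tested on stars, which are bipartite and hence admissible.  The
-- star of a vertex 𝔞 = (x, D) of E_o(R) realises 𝔞 at its centre, so the neighbours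
-- of 𝔞 in E(R) lie over exactly the points of D, i.e. α_{E(R),φ_R} is the identity;
-- compatibility with ξ and φ_R then yields Condition 1, and its first component
-- says that ε induces ρ.  For injectivity, ε(𝔞) = ε(𝔟) matches the spokes of the
-- stars of 𝔞 and 𝔟 through their images under ρ; a matched pair of spokes gives two
-- edges K₂ → R with equal images under ρ, hence, ρ being strong, equal edges.
-- Empty 𝔞 are handled in the same way with the one-point graph.

module Submission where

open import Defs
open import Data.Nat using (ℕ; zero; suc; _+_; _*_)
open import Data.Bool using (Bool; true; false)
open import Data.Fin using (Fin; zero; suc; _≟_; inject₁; fromℕ)
open import Data.Fin.Properties using (any?)
open import Data.Fin.Subset using (Subset; _∈_; _⊆_; ⁅_⁆; Nonempty) renaming (⊥ to ∅)
open import Data.Fin.Subset.Properties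
  using (_∈?_; ⊆-antisym; x∈⁅x⁆; x∈⁅y⁆⇒x≡y; nonempty?; Empty-unique; ∉⊥)
open import Data.Vec using (tabulate; lookup)
open import Data.Vec.Properties using (lookup∘tabulate; []=⇒lookup; lookup⇒[]=)
open import Data.Product using (∃; _×_; _,_; proj₁; proj₂)
open import Data.Sum using (_⊎_; inj₁; inj₂; [_,_]′)
open import Function using (_∘_; case_of_)
open import Function.Bundles using (Inverse; Injection; Equivalence)
open import Function.Definitions using (Injective)
open import Function.Properties.Inverse using (Inverse⇒Injection)
open import Relation.Nullary using (Dec; yes; no; does; contradiction)
open import Relation.Nullary.Decidable using (_×-dec_; ¬?; dec-true; recompute)
open import Relation.Binary.PropositionalEquality
  using (_≡_; _≢_; refl; sym; trans; cong; subst; subst₂)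

does-true⇒ : {A : Set} (d : Dec A) → does d ≡ true → A
does-true⇒ (yes a) _ = a
does-true⇒ (no _) ()

module _ {k : ℕ} where

  ∈-tabulate⁻ : ∀ f {u : Fin k} → u ∈ tabulate f → f u ≡ true
  ∈-tabulate⁻ f {u} p = trans (sym (lookup∘tabulate f u)) ([]=⇒lookup p)

  ∈-tabulate⁺ : ∀ f {u : Fin k} → f u ≡ true → u ∈ tabulate f
  ∈-tabulate⁺ f {u} e = lookup⇒[]= u (tabulate f) (trans (lookup∘tabulate f u) e)

  ⁅⁆-injective : Injective _≡_ _≡_ (⁅_⁆ {k})
  ⁅⁆-injective {x} {y} e = x∈⁅y⁆⇒x≡y y (subst (x ∈_) e (x∈⁅x⁆ x))

module _ {k m : ℕ} (f : Fin k → Fin m) where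

  ∈-image⁻ : ∀ D {u} → u ∈ image f D → ∃ λ w → w ∈ D × f w ≡ u
  ∈-image⁻ D {u} p = does-true⇒ (any? λ w → (w ∈? D) ×-dec (f w ≟ u)) (∈-tabulate⁻ _ p)

  ∈-image⁺ : ∀ D {w} → w ∈ D → f w ∈ image f D
  ∈-image⁺ D {w} p =
    ∈-tabulate⁺ _ (dec-true (any? λ w′ → (w′ ∈? D) ×-dec (f w′ ≟ f w)) (w , p , refl))

  image-⁅⁆ : ∀ w → image f ⁅ w ⁆ ≡ ⁅ f w ⁆
  image-⁅⁆ w = ⊆-antisym forth back
    where
    forth : image f ⁅ w ⁆ ⊆ ⁅ f w ⁆
    forth p with ∈-image⁻ ⁅ w ⁆ p
    ... | w′ , w′∈ , refl rewrite x∈⁅y⁆⇒x≡y w w′∈ = x∈⁅x⁆ (f w)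
    back : ⁅ f w ⁆ ⊆ image f ⁅ w ⁆
    back p rewrite x∈⁅y⁆⇒x≡y (f w) p = ∈-image⁺ ⁅ w ⁆ (x∈⁅x⁆ w)

  image-∅ : image f ∅ ≡ ∅
  image-∅ = Empty-unique λ (_ , p) → ∉⊥ (proj₁ (proj₂ (∈-image⁻ ∅ p)))

module _ (G : Graph) (v : V G) {w : V G} where

  ∈-nbhd⁻ : w ∈ nbhd G v → AdjStar G v w
  ∈-nbhd⁻ p = does-true⇒ (Adj? G v w ×-dec ¬? (v ≟ w)) (∈-tabulate⁻ _ p)

  ∈-nbhd⁺ : AdjStar G v w → w ∈ nbhd G v
  ∈-nbhd⁺ a = ∈-tabulate⁺ _ (dec-true (Adj? G v w ×-dec ¬? (v ≟ w)) a)

Eo-≡ : ∀ {T} {𝔞 𝔟 : Eo T} → vtx 𝔞 ≡ vtx 𝔟 → set 𝔞 ≡ set 𝔟 → 𝔞 ≡ 𝔟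
Eo-≡ {𝔞 = ⟨ _ , _ , _ ⟩} {⟨ _ , _ , _ ⟩} refl refl = refl

set⇒AdjStar : ∀ {T} (𝔞 : Eo T) {u} → u ∈ set 𝔞 → AdjStar T (vtx 𝔞) u
set⇒AdjStar {T} ⟨ x , D , D⊆ ⟩ {u} p = ∈-nbhd⁻ T x (recompute (u ∈? nbhd T x) (D⊆ p))

set-α-pendant : ∀ {T G} (ξ : SHom G T) v w →
                nbhd G v ≡ ⁅ w ⁆ → set (α T G ξ v) ≡ ⁅ map ξ w ⁆
set-α-pendant ξ v w e = trans (cong (image (map ξ)) e) (image-⁅⁆ (map ξ) w)

starAdj : ∀ {k} → Subset k → Fin (suc k) → Fin (suc k) → Bool
starAdj D zero    (suc u) = lookup D u
starAdj D (suc u) zero    = lookup D u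
starAdj D _       _       = false

-- Centre zero, one leaf suc u per u ∈ D, and isolated vertices suc u for u ∉ D.
star : (k : ℕ) → Subset k → Graph
star k D = record { n = suc k ; adj = starAdj D ; adj-sym = sym′ }
  where
  sym′ : ∀ v w → starAdj D v w ≡ starAdj D w v
  sym′ zero    zero    = refl
  sym′ zero    (suc _) = refl
  sym′ (suc _) zero    = refl
  sym′ (suc _) (suc _) = refl

module _ {k : ℕ} (D : Subset k) where

  centre-neighbour : ∀ {x} → x ∈ nbhd (star k D) zero → ∃ λ u → x ≡ suc u × u ∈ D
  centre-neighbour {zero}  p = contradiction refl (proj₂ (∈-nbhd⁻ (star k D) zero p))
  centre-neighbour {suc u} p = u , refl , lookup⇒[]= u D (proj₁ (∈-nbhd⁻ (star k D) zero p))

  leaf∈nbhd-centre : ∀ {u} → u ∈ D → suc u ∈ nbhd (star k D) zero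
  leaf∈nbhd-centre u∈ = ∈-nbhd⁺ (star k D) zero ([]=⇒lookup u∈ , λ ())

  ∈-image-centre⁻ : ∀ {m} (f : Fin (suc k) → Fin m) {y} → y ∈ image f (nbhd (star k D) zero) →
                    ∃ λ u → u ∈ D × f (suc u) ≡ y
  ∈-image-centre⁻ f p with ∈-image⁻ f (nbhd (star k D) zero) p
  ... | _ , x∈ , refl with centre-neighbour x∈
  ...   | u , refl , u∈ = u , u∈ , refl

  nbhd-leaf : ∀ {u} → u ∈ D → nbhd (star k D) (suc u) ≡ ⁅ zero ⁆
  nbhd-leaf {u} u∈ = ⊆-antisym forth back
    where
    forth : nbhd (star k D) (suc u) ⊆ ⁅ zero ⁆
    forth {zero}  _ = x∈⁅x⁆ zero
    forth {suc _} p = case proj₁ (∈-nbhd⁻ (star k D) (suc u) p) of λ ()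
    back : ⁅ zero ⁆ ⊆ nbhd (star k D) (suc u)
    back p rewrite x∈⁅y⁆⇒x≡y zero p = ∈-nbhd⁺ (star k D) (suc u) ([]=⇒lookup u∈ , λ ())

edge-after-γ₂ : ∀ G m (γ : Fin (suc (2 + 2 * m)) → V G) →
                (∀ (i : Fin (2 + 2 * m)) → AdjStar G (γ (inject₁ i)) (γ (suc i))) →
                AdjStar G (γ (fromℕ (2 + 2 * m))) (γ zero) →
                ∃ λ j → j ≢ suc zero × AdjStar G (γ (suc (suc zero))) (γ j)
edge-after-γ₂ G zero    γ path close = zero , (λ ()) , close
edge-after-γ₂ G (suc m) γ path close = suc (suc (suc zero)) , (λ ()) , path (suc (suc zero))

-- The edges γ₀γ₁ and γ₁γ₂ of an odd cycle force γ₁ to be the centre; then the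
-- edge leaving γ₂ misses the centre, as its ends differ from γ₁.
Co-centred : (G : Graph) (c : V G) → (∀ a b → AdjStar G a b → a ≡ c ⊎ b ≡ c) → Co G
Co-centred G c centred (m , γ , γ-inj , path , close) with γ (suc zero) ≟ c
... | no γ₁≢c = case (centred _ _ (path zero) , centred _ _ (path (suc zero))) of λ where
  (inj₂ γ₁≡c , _)         → γ₁≢c γ₁≡c
  (_ , inj₁ γ₁≡c)         → γ₁≢c γ₁≡c
  (inj₁ γ₀≡c , inj₂ γ₂≡c) → case γ-inj (trans γ₀≡c (sym γ₂≡c)) of λ ()
... | yes γ₁≡c with edge-after-γ₂ G m γ path close
...   | j , j≢1 , γ₂γⱼ = case centred _ _ γ₂γⱼ of λ where
  (inj₁ γ₂≡c) → case γ-inj (trans γ₂≡c (sym γ₁≡c)) of λ ()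
  (inj₂ γⱼ≡c) → j≢1 (γ-inj (trans γⱼ≡c (sym γ₁≡c)))

star-Co : ∀ k D → Co (star k D)
star-Co k D = Co-centred (star k D) zero centred
  where
  centred : ∀ a b → AdjStar (star k D) a b → a ≡ zero ⊎ b ≡ zero
  centred zero    _       _       = inj₁ refl
  centred (suc _) zero    _       = inj₂ refl
  centred (suc _) (suc _) (() , _)

AdjStar-sym : ∀ G {v w} → AdjStar G v w → AdjStar G w v
AdjStar-sym G {v} {w} (vw , v≢w) = trans (adj-sym G w v) vw , v≢w ∘ sym

star-hom : (T : Graph) (𝔞 : Eo T) → SHom (star (n T) (set 𝔞)) T
star-hom T 𝔞 = shom σ σ-strict
  where
  σ : Fin (suc (n T)) → V T
  σ zero    = vtx 𝔞
  σ (suc u) = u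
  spoke : ∀ {u} → lookup (set 𝔞) u ≡ true → AdjStar T (vtx 𝔞) u
  spoke {u} e = set⇒AdjStar 𝔞 (lookup⇒[]= u (set 𝔞) e)
  σ-strict : IsStrict (star (n T) (set 𝔞)) T σ
  σ-strict zero    (suc _) e = proj₁ (spoke e) , λ _ → proj₂ (spoke e)
  σ-strict (suc _) zero    e =
    proj₁ (AdjStar-sym T (spoke e)) , λ _ → proj₂ (AdjStar-sym T (spoke e))
  σ-strict zero    zero    ()
  σ-strict (suc _) (suc _) ()

K₂ : Graph
K₂ = star 1 ⁅ zero ⁆

edge-hom : (T : Graph) {a b : V T} → AdjStar T a b → SHom K₂ T
edge-hom T {a} {b} ab = shom ends ends-strict
  where
  ends : Fin 2 → V T
  ends zero       = a
  ends (suc zero) = b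
  ends-strict : IsStrict K₂ T ends
  ends-strict zero       (suc zero) _ = proj₁ ab , λ _ → proj₂ ab
  ends-strict (suc zero) zero       _ = proj₁ (AdjStar-sym T ab) , λ _ → proj₂ (AdjStar-sym T ab)
  ends-strict zero       zero       ()
  ends-strict (suc zero) (suc zero) ()

point-hom : (T : Graph) → V T → SHom (star 0 ∅) T
point-hom T x = shom (λ _ → x) λ { zero zero () }

module _ (T : Graph) (𝔞 : Eo T) where

  α-star-centre : α T (star (n T) (set 𝔞)) (star-hom T 𝔞) zero ≡ 𝔞
  α-star-centre = Eo-≡ refl (⊆-antisym forth back)
    where
    σ : Fin (suc (n T)) → V T
    σ = map (star-hom T 𝔞)
    forth : image σ (nbhd (star (n T) (set 𝔞)) zero) ⊆ set 𝔞
    forth p with ∈-image-centre⁻ (set 𝔞) σ p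
    ... | _ , u∈ , refl = u∈
    back : set 𝔞 ⊆ image σ (nbhd (star (n T) (set 𝔞)) zero)
    back u∈ = ∈-image⁺ σ _ (leaf∈nbhd-centre (set 𝔞) u∈)

  α-edge≡α-leaf : ∀ {u} (u∈ : u ∈ set 𝔞) →
                  α T K₂ (edge-hom T (set⇒AdjStar 𝔞 u∈)) (suc zero)
                  ≡ α T (star (n T) (set 𝔞)) (star-hom T 𝔞) (suc u)
  α-edge≡α-leaf {u} u∈ = Eo-≡ refl
    (trans (set-α-pendant (edge-hom T (set⇒AdjStar 𝔞 u∈)) (suc zero) zero
                          (nbhd-leaf ⁅ zero ⁆ (x∈⁅x⁆ zero)))
           (sym (set-α-pendant (star-hom T 𝔞) (suc u) zero (nbhd-leaf (set 𝔞) u∈))))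

  α-point : set 𝔞 ≡ ∅ → α T (star 0 ∅) (point-hom T (vtx 𝔞)) zero ≡ 𝔞
  α-point e = Eo-≡ refl (trans (image-∅ (map (point-hom T (vtx 𝔞)))) (sym e))

EVEdge⇒vtx∈set : ∀ {U' T} {𝔞 𝔟 : Eo T} → EVEdge U' T 𝔞 𝔟 → 𝔞 ≢ 𝔟 → vtx 𝔟 ∈ set 𝔞
EVEdge⇒vtx∈set (G , _ , ξ , v , w , vw , refl , refl) 𝔞≢𝔟 with v ≟ w
... | yes refl = contradiction refl 𝔞≢𝔟
... | no v≢w   = ∈-image⁺ (map ξ) (nbhd G v) (∈-nbhd⁺ G v (vw , v≢w))

star-EVEdge : ∀ {U'} T (𝔞 : Eo T) → U' (star (n T) (set 𝔞)) → ∀ {u} → u ∈ set 𝔞 →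
              EVEdge U' T 𝔞 (α T (star (n T) (set 𝔞)) (star-hom T 𝔞) (suc u))
star-EVEdge T 𝔞 star∈U' u∈ =
  star (n T) (set 𝔞) , star∈U' , star-hom T 𝔞 , zero , suc _ ,
  []=⇒lookup u∈ , α-star-centre T 𝔞 , refl

-- An EV-edge out of 𝔞 ends over a point of set 𝔞; conversely the star of 𝔞
-- provides an EV-edge to a vertex over any u ∈ set 𝔞.
α-φE : ∀ {U' T} (E : EVSystem U' T) → (∀ D → U' (star (n T) D)) →
       ∀ 𝔞 → α T (graph E) (φE-hom E) (Inverse.from (enum E) 𝔞) ≡ 𝔞
α-φE {U'} {T} E stars∈U' 𝔞 = Eo-≡ (cong vtx (to∘from 𝔞)) (⊆-antisym forth back)
  where
  open Inverse (enum E) using (to; from) renaming (strictlyInverseˡ to to∘from)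
  to-injective : Injective _≡_ _≡_ to
  to-injective = Injection.injective (Inverse⇒Injection (enum E))
  𝔞-nbhd : Subset (n (graph E))
  𝔞-nbhd = nbhd (graph E) (from 𝔞)
  forth : image (φE E) 𝔞-nbhd ⊆ set 𝔞
  forth p with ∈-image⁻ (φE E) 𝔞-nbhd p
  ... | y , y∈ , refl = subst (λ 𝔠 → vtx (to y) ∈ set 𝔠) (to∘from 𝔞)
    (EVEdge⇒vtx∈set (Equivalence.to (edges E (from 𝔞) y) (proj₁ xy)) (proj₂ xy ∘ to-injective))
    where
    xy : AdjStar (graph E) (from 𝔞) y
    xy = ∈-nbhd⁻ (graph E) (from 𝔞) y∈
  back : set 𝔞 ⊆ image (φE E) 𝔞-nbhd
  back {u} u∈ = subst (_∈ image (φE E) 𝔞-nbhd) (cong vtx (to∘from 𝔟))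
                  (∈-image⁺ (φE E) 𝔞-nbhd (∈-nbhd⁺ (graph E) (from 𝔞) (adjacent , distinct)))
    where
    𝔟 : Eo T
    𝔟 = α T (star (n T) (set 𝔞)) (star-hom T 𝔞) (suc u)
    adjacent : Adj (graph E) (from 𝔞) (from 𝔟)
    adjacent = Equivalence.from (edges E (from 𝔞) (from 𝔟))
      (subst₂ (EVEdge U' T) (sym (to∘from 𝔞)) (sym (to∘from 𝔟))
              (star-EVEdge T 𝔞 (stars∈U' (set 𝔞)) u∈))
    distinct : from 𝔞 ≢ from 𝔟
    distinct e = proj₂ (set⇒AdjStar 𝔞 u∈)
      (cong vtx (trans (sym (to∘from 𝔞)) (trans (cong to e) (to∘from 𝔟))))

module _ {U' : Graph → Set} {R S : Graph} (stars∈U' : ∀ k D → U' (star k D))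
         (E : EVSystem U' R) .(E∈U' : U' (graph E))
         (ρ : SScheme U' R S) (compatible : Compatible ρ) where

  εE : Eo R → Eo S
  εE = ε ρ E E∈U'

  ε-condition₁ : ∀ G .(p : U' G) (ξ : SHom G R) v → α S G (ρ G p ξ) v ≡ εE (α R G ξ v)
  ε-condition₁ G p ξ v = compatible G (graph E) p E∈U' ξ (φE-hom E) v _
    (sym (α-φE E (stars∈U' (n R)) (α R G ξ v)))

  ε-induces : ∀ G .(p : U' G) (ξ : SHom G R) v → map (ρ G p ξ) v ≡ φ S (εE (α R G ξ v))
  ε-induces G p ξ v = cong vtx (ε-condition₁ G p ξ v)

  ρ-star : (𝔞 : Eo R) → SHom (star (n R) (set 𝔞)) S
  ρ-star 𝔞 = ρ _ (stars∈U' _ _) (star-hom R 𝔞)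

  α-ρ-star-centre : (𝔞 : Eo R) → α S _ (ρ-star 𝔞) zero ≡ εE 𝔞
  α-ρ-star-centre 𝔞 = trans (ε-condition₁ _ _ (star-hom R 𝔞) zero) (cong εE (α-star-centre R 𝔞))

  spoke∈ε : (𝔞 : Eo R) → ∀ {u} → u ∈ set 𝔞 → map (ρ-star 𝔞) (suc u) ∈ set (εE 𝔞)
  spoke∈ε 𝔞 {u} u∈ = subst (λ 𝔠 → map (ρ-star 𝔞) (suc u) ∈ set 𝔠) (α-ρ-star-centre 𝔞)
    (∈-image⁺ (map (ρ-star 𝔞)) (nbhd (star (n R) (set 𝔞)) zero) (leaf∈nbhd-centre (set 𝔞) u∈))

  edge-at : (𝔞 : Eo R) → ∀ {u} → u ∈ set 𝔞 → SHom K₂ R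
  edge-at 𝔞 u∈ = edge-hom R (set⇒AdjStar 𝔞 u∈)

  ρ-edge : (𝔞 : Eo R) → ∀ {u} → u ∈ set 𝔞 → SHom K₂ S
  ρ-edge 𝔞 u∈ = ρ K₂ (stars∈U' 1 ⁅ zero ⁆) (edge-at 𝔞 u∈)

  -- Compatibility identifies the leaf of the edge with the leaf u of the star of 𝔞;
  -- their unique neighbours then have the same image.
  ρ-edge-ends : (𝔞 : Eo R) {u : V R} (u∈ : u ∈ set 𝔞) →
                map (ρ-edge 𝔞 u∈) zero ≡ φ S (εE 𝔞)
                × map (ρ-edge 𝔞 u∈) (suc zero) ≡ map (ρ-star 𝔞) (suc u)
  ρ-edge-ends 𝔞 {u} u∈ = trans centres (cong vtx (α-ρ-star-centre 𝔞)) , cong vtx leaves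
    where
    leaves : α S K₂ (ρ-edge 𝔞 u∈) (suc zero) ≡ α S (star (n R) (set 𝔞)) (ρ-star 𝔞) (suc u)
    leaves = compatible K₂ (star (n R) (set 𝔞)) _ _ (edge-at 𝔞 u∈) (star-hom R 𝔞)
               (suc zero) (suc u) (α-edge≡α-leaf R 𝔞 u∈)
    centres : map (ρ-edge 𝔞 u∈) zero ≡ map (ρ-star 𝔞) zero
    centres = ⁅⁆-injective
      (trans (sym (set-α-pendant (ρ-edge 𝔞 u∈) (suc zero) zero (nbhd-leaf ⁅ zero ⁆ (x∈⁅x⁆ zero))))
        (trans (cong set leaves) (set-α-pendant (ρ-star 𝔞) (suc u) zero (nbhd-leaf (set 𝔞) u∈))))

  module _ (strong : Strong ρ) where

    -- The spoke of the star of 𝔞 at u is a spoke of the star of 𝔟, at some u′;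
    -- strongness applied to the two edges (vtx 𝔞, u) and (vtx 𝔟, u′) gives the claim.
    ε-≡⇒spoke : ∀ {𝔞 𝔟 : Eo R} → εE 𝔞 ≡ εE 𝔟 → ∀ {u} → u ∈ set 𝔞 →
                vtx 𝔞 ≡ vtx 𝔟 × u ∈ set 𝔟
    ε-≡⇒spoke {𝔞} {𝔟} h {u} u∈ =
      edges-agree zero , subst (_∈ set 𝔟) (sym (edges-agree (suc zero))) u′∈
      where
      matching-spoke : ∃ λ u′ → u′ ∈ set 𝔟 × map (ρ-star 𝔟) (suc u′) ≡ map (ρ-star 𝔞) (suc u)
      matching-spoke = ∈-image-centre⁻ (set 𝔟) (map (ρ-star 𝔟))
        (subst (λ 𝔠 → map (ρ-star 𝔞) (suc u) ∈ set 𝔠) (trans h (sym (α-ρ-star-centre 𝔟)))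
               (spoke∈ε 𝔞 u∈))
      u′∈ : proj₁ matching-spoke ∈ set 𝔟
      u′∈ = proj₁ (proj₂ matching-spoke)
      ρ-edges-agree : ∀ v → map (ρ-edge 𝔞 u∈) v ≡ map (ρ-edge 𝔟 u′∈) v
      ρ-edges-agree zero       = trans (proj₁ (ρ-edge-ends 𝔞 u∈))
                                   (trans (cong vtx h) (sym (proj₁ (ρ-edge-ends 𝔟 u′∈))))
      ρ-edges-agree (suc zero) = trans (proj₂ (ρ-edge-ends 𝔞 u∈))
                                   (trans (sym (proj₂ (proj₂ matching-spoke)))
                                          (sym (proj₂ (ρ-edge-ends 𝔟 u′∈))))
      edges-agree : ∀ v → map (edge-at 𝔞 u∈) v ≡ map (edge-at 𝔟 u′∈) v
      edges-agree = strong K₂ (stars∈U' 1 ⁅ zero ⁆) (edge-at 𝔞 u∈) (edge-at 𝔟 u′∈) ρ-edges-agree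

    ε-≡⇒vtx≡-∅ : ∀ {𝔞 𝔟 : Eo R} → εE 𝔞 ≡ εE 𝔟 → set 𝔞 ≡ ∅ → set 𝔟 ≡ ∅ → vtx 𝔞 ≡ vtx 𝔟
    ε-≡⇒vtx≡-∅ {𝔞} {𝔟} h 𝔞∅ 𝔟∅ = strong (star 0 ∅) (stars∈U' 0 ∅)
      (point-hom R (vtx 𝔞)) (point-hom R (vtx 𝔟)) ρ-points-agree zero
      where
      ρ-point : (𝔠 : Eo R) → set 𝔠 ≡ ∅ →
                map (ρ (star 0 ∅) (stars∈U' 0 ∅) (point-hom R (vtx 𝔠))) zero ≡ φ S (εE 𝔠)
      ρ-point 𝔠 𝔠∅ = trans (ε-induces _ _ (point-hom R (vtx 𝔠)) zero)
                       (cong (φ S ∘ εE) (α-point R 𝔠 𝔠∅))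
      ρ-points-agree : ∀ v → map (ρ _ (stars∈U' 0 ∅) (point-hom R (vtx 𝔞))) v
                           ≡ map (ρ _ (stars∈U' 0 ∅) (point-hom R (vtx 𝔟))) v
      ρ-points-agree zero = trans (ρ-point 𝔞 𝔞∅) (trans (cong vtx h) (sym (ρ-point 𝔟 𝔟∅)))

    ε-injective : Injective _≡_ _≡_ (εE)
    ε-injective {𝔞} {𝔟} h = by-emptiness (nonempty? (set 𝔞))
      where
      by-emptiness : Dec (Nonempty (set 𝔞)) → 𝔞 ≡ 𝔟
      by-emptiness (yes (_ , u∈)) =
        Eo-≡ (proj₁ (ε-≡⇒spoke h u∈))
             (⊆-antisym (proj₂ ∘ ε-≡⇒spoke h) (proj₂ ∘ ε-≡⇒spoke (sym h)))
      by-emptiness (no 𝔞-empty) =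
        Eo-≡ (ε-≡⇒vtx≡-∅ h 𝔞∅ 𝔟∅) (trans 𝔞∅ (sym 𝔟∅))
        where
        𝔞∅ : set 𝔞 ≡ ∅
        𝔞∅ = Empty-unique 𝔞-empty
        𝔟∅ : set 𝔟 ≡ ∅
        𝔟∅ = Empty-unique λ (_ , u∈) → 𝔞-empty (_ , proj₂ (ε-≡⇒spoke (sym h) u∈))

theorem8 : (U' : Graph → Set) (R S : Graph) →
    ((∀ G → U' G) ⊎ (Co R × (∀ G → Co G → U' G))) →
    (E : EVSystem U' R) → .(E∈U' : U' (graph E)) →
    (ρ : SScheme U' R S) → Strong ρ → Compatible ρ →
    Injective _≡_ _≡_ (ε ρ E E∈U')
    × (∀ G .(p : U' G) (ξ : SHom G R) (v : V G) →
         map (ρ G p ξ) v ≡ φ S (ε ρ E E∈U' (α R G ξ v)))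
    × (∀ G .(p : U' G) (ξ : SHom G R) (v : V G) →
         α S G (ρ G p ξ) v ≡ ε ρ E E∈U' (α R G ξ v))
theorem8 U' R S hyp E E∈U' ρ strong compatible =
  ε-injective stars∈U' E E∈U' ρ compatible strong ,
  ε-induces stars∈U' E E∈U' ρ compatible ,
  ε-condition₁ stars∈U' E E∈U' ρ compatible
  where
  stars∈U' : ∀ k D → U' (star k D)
  stars∈U' k D = [ (λ all → all _) , (λ (_ , Co⊆U') → Co⊆U' _ (star-Co k D)) ]′ hyp
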